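{- For every finite hypergraph $H$, $\mathrm{ch}_{\mathrm{um}}(H)\le\Delta(H)+1$.
   Context: $\Delta(H)$ is the maximum, over vertices $v$, of the number of hyperedges containing $v$. A unique-maximum coloring of $H=(V,\mathcal{E})$ is a coloring $C\colon V\to\mathbb{Z}_{>0}$ such that in every hyperedge the maximum color occurs on exactly one vertex. $\mathrm{ch}_{\mathrm{um}}(H)$ is the minimum $k$ such that for every family $\{L_v\}_{v\in V}$ of sets of positive integers with $|L_v|\ge k$ there is a unique-maximum coloring with $C(v)\in L_v$ for all $v$. -}

module Defs where

open import Data.Nat using (ℕ; zero; suc; _≤_; _<_; _⊔_)
open import Data.Fin using (Fin)
open import Data.Fin.Subset using (Subset; _∈_; Nonempty)
open import Data.Fin.Subset.Properties using (_∈?_)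
open import Data.List using (List; length; filter; map; foldr; allFin)
open import Data.List.Relation.Unary.All using (All)
open import Data.List.Relation.Unary.Unique.Propositional using (Unique)
import Data.List.Membership.Propositional as LMem
open import Data.Product using (Σ; _×_; ∃)
open import Relation.Binary.PropositionalEquality using (_≡_)

record Hypergraph : Set where
  field
    n : ℕ
    m : ℕ
    edge : Fin m → Subset n
    edge-nonempty : (i : Fin m) → Nonempty (edge i)
open Hypergraph public

degree : (H : Hypergraph) → Fin (n H) → ℕ
degree H v = length (filter (λ i → v ∈? edge H i) (allFin (m H)))

Δ : Hypergraph → ℕ
Δ H = foldr _⊔_ 0 (map (degree H) (allFin (n H)))

IsUMColoring : (H : Hypergraph) → (Fin (n H) → ℕ) → Set
IsUMColoring H C =
  (i : Fin (m H)) → Σ (Fin (n H)) λ v → v ∈ edge H i ×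
    ((w : Fin (n H)) → w ∈ edge H i → C w ≤ C v) ×
    ((w : Fin (n H)) → w ∈ edge H i → C w ≡ C v → w ≡ v)

IsListOfSize : ℕ → List ℕ → Set
IsListOfSize k L = Unique L × All (λ x → 0 < x) L × k ≤ length L

UMChoosable : Hypergraph → ℕ → Set
UMChoosable H k =
  (L : Fin (n H) → List ℕ) → ((v : Fin (n H)) → IsListOfSize k (L v)) →
  Σ (Fin (n H) → ℕ) λ C → ((v : Fin (n H)) → C v LMem.∈ L v) × IsUMColoring H C

module Submission where

-- Colour greedily, one vertex at a time, keeping every hyperedge either uncoloured or with a
-- unique maximum among its coloured vertices.  A vertex u lies in at most Δ hyperedges, so
-- among the Δ + 1 colours of its list there is one differing from the current maximum of
-- each of them.  Giving u that colour keeps the invariant: a hyperedge through u either keeps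
-- its old unique maximum (the new colour is smaller) or gets u as its new unique maximum.

open import Data.Nat using (ℕ; suc; _≤_; _<_; _⊔_; z≤n; s≤s)
open import Data.Nat.Properties
  using (<-cmp; ≤-refl; ≤-trans; <-≤-trans; ≤-<-trans; m≤m⊔n; m≤n⊔m; <⇒≢; <⇒≤; ≤-pred; n≮0)
  renaming (_≟_ to _≟ℕ_)
open import Data.Fin using (Fin) renaming (_≟_ to _≟ᶠ_)
open import Data.Fin.Subset using (Subset; _∈_; Nonempty)
open import Data.Fin.Subset.Properties using (_∈?_)
open import Data.List using (List; []; _∷_; length; filter; map; foldr; allFin)
open import Data.List.Properties using (length-map; filter-notAll)
import Data.List.Relation.Unary.All as All
open import Data.List.Relation.Unary.Any using (here; there)
import Data.List.Relation.Unary.Any as Any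
open import Data.List.Relation.Unary.Unique.Propositional using (Unique)
open import Data.List.Relation.Unary.AllPairs using (_∷_)
open import Data.List.Membership.Propositional using () renaming (_∈_ to _∈ˡ_; _∉_ to _∉ˡ_)
open import Data.List.Membership.Propositional.Properties using (∈-allFin; ∈-map⁺; ∈-filter⁺)
import Data.List.Membership.DecPropositional as DecMembership
open import Data.Vec.Functional using (updateAt)
open import Data.Vec.Functional.Properties using (updateAt-updates; updateAt-minimal)
open import Data.Product using (Σ; ∃; _×_; _,_; proj₁; proj₂; map₂)
open import Data.Sum using (_⊎_; inj₁; inj₂)
import Data.Sum as Sum
open import Data.Empty using (⊥-elim)
open import Function using (const)
open import Relation.Nullary using (Dec; yes; no; ¬?)
open import Relation.Binary.Definitions using (DecidableEquality; tri<; tri≈; tri>)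
open import Relation.Binary.PropositionalEquality using (_≡_; _≢_; refl; sym; trans; subst)
open import Defs

≤-foldr-⊔ : ∀ {x xs} → x ∈ˡ xs → x ≤ foldr _⊔_ 0 xs
≤-foldr-⊔ {xs = y ∷ ys} (here refl) = m≤m⊔n y _
≤-foldr-⊔ {xs = y ∷ ys} (there x∈) = ≤-trans (≤-foldr-⊔ x∈) (m≤n⊔m y _)

module _ {A : Set} (_≟_ : DecidableEquality A) where

  open DecMembership _≟_ using () renaming (_∈?_ to _∈ˡ?_)

  ∃-∈-∉-shorter : (xs ys : List A) → Unique xs → length ys < length xs →
                  ∃ λ x → x ∈ˡ xs × x ∉ˡ ys
  ∃-∈-∉-shorter (x ∷ xs) ys (x∉xs ∷ xs-unique) ys<x∷xs with x ∈ˡ? ys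
  ... | no x∉ys = x , here refl , x∉ys
  ... | yes x∈ys =
    let y , y∈xs , y∉ys-x = ∃-∈-∉-shorter xs ys-x xs-unique ys-x<xs
    in y , there y∈xs , λ y∈ys →
         y∉ys-x (∈-filter⁺ ≢x? y∈ys (λ y≡x → All.lookup x∉xs y∈xs (sym y≡x)))
    where
    ≢x? : (y : A) → Dec (y ≢ x)
    ≢x? y = ¬? (y ≟ x)
    ys-x : List A
    ys-x = filter ≢x? ys
    ys-x<xs : length ys-x < length xs
    ys-x<xs = <-≤-trans (filter-notAll ≢x? ys (Any.map (λ y≡x y≢x → y≢x (sym y≡x)) x∈ys))
                        (≤-pred ys<x∷xs)

module _ {n : ℕ} where

  IsMaxIn : (Fin n → ℕ) → Subset n → Fin n → Set
  IsMaxIn C e v = v ∈ e × ((w : Fin n) → w ∈ e → C w ≤ C v)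

  IsUniqueIn : (Fin n → ℕ) → Subset n → Fin n → Set
  IsUniqueIn C e v = (w : Fin n) → w ∈ e → C w ≡ C v → w ≡ v

  -- Colour 0 marks an uncoloured vertex.
  UniqueMaxUnlessUncoloured : (Fin n → ℕ) → Subset n → Set
  UniqueMaxUnlessUncoloured C e = Σ (Fin n) λ v → IsMaxIn C e v × (C v ≡ 0 ⊎ IsUniqueIn C e v)

  top : ∀ {C e} → UniqueMaxUnlessUncoloured C e → Fin n
  top = proj₁

  uncoloured-uniqueMaxUnlessUncoloured : ∀ {e} → Nonempty e → UniqueMaxUnlessUncoloured (const 0) e
  uncoloured-uniqueMaxUnlessUncoloured (v , v∈e) = v , (v∈e , λ _ _ → z≤n) , inj₁ refl

  paint : (Fin n → ℕ) → Fin n → ℕ → Fin n → ℕ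
  paint C u c = updateAt C u (const c)

  paint-cases : ∀ C u c w → (w ≡ u × paint C u c w ≡ c) ⊎ (w ≢ u × paint C u c w ≡ C w)
  paint-cases C u c w with w ≟ᶠ u
  ... | yes refl = inj₁ (refl , updateAt-updates u C)
  ... | no w≢u = inj₂ (w≢u , updateAt-minimal w u C w≢u)

  paint-elsewhere : ∀ C u c {w} → w ≢ u → paint C u c w ≡ C w
  paint-elsewhere C u c w≢u = updateAt-minimal _ u C w≢u

  uniqueMaxUnlessUncoloured-cong : ∀ {C C′ e} → ((w : Fin n) → w ∈ e → C′ w ≡ C w) →
    UniqueMaxUnlessUncoloured C e → UniqueMaxUnlessUncoloured C′ e
  uniqueMaxUnlessUncoloured-cong {C} {C′} {e} C′≡C (v , (v∈e , max) , zero-or-unique) =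
    v , (v∈e , max′) , Sum.map (trans (C′≡C v v∈e)) unique′ zero-or-unique
    where
    max′ : (w : Fin n) → w ∈ e → C′ w ≤ C′ v
    max′ w w∈e rewrite C′≡C w w∈e | C′≡C v v∈e = max w w∈e
    unique′ : IsUniqueIn C e v → IsUniqueIn C′ e v
    unique′ unique w w∈e Cw≡Cv = unique w w∈e (trans (sym (C′≡C w w∈e)) (trans Cw≡Cv (C′≡C v v∈e)))

  paint-below-uniqueMax : ∀ {C e v} u {c} → v ≢ u → c < C v →
    IsMaxIn C e v → IsUniqueIn C e v →
    IsMaxIn (paint C u c) e v × IsUniqueIn (paint C u c) e v
  paint-below-uniqueMax {C} {e} {v} u {c} v≢u c<Cv (v∈e , max) unique = (v∈e , max′) , unique′
    where
    Cv-kept : paint C u c v ≡ C v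
    Cv-kept = paint-elsewhere C u c v≢u
    max′ : (w : Fin n) → w ∈ e → paint C u c w ≤ paint C u c v
    max′ w w∈e rewrite Cv-kept with paint-cases C u c w
    ... | inj₁ (_ , painted) rewrite painted = <⇒≤ c<Cv
    ... | inj₂ (_ , kept) rewrite kept = max w w∈e
    unique′ : IsUniqueIn (paint C u c) e v
    unique′ w w∈e eq rewrite Cv-kept with paint-cases C u c w
    ... | inj₁ (_ , painted) = ⊥-elim (<⇒≢ c<Cv (trans (sym painted) eq))
    ... | inj₂ (_ , kept) = unique w w∈e (trans (sym kept) eq)

  paint-above-all : ∀ {C e u c} → u ∈ e → ((w : Fin n) → w ∈ e → C w < c) →
    IsMaxIn (paint C u c) e u × IsUniqueIn (paint C u c) e u
  paint-above-all {C} {e} {u} {c} u∈e below = (u∈e , max) , unique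
    where
    max : (w : Fin n) → w ∈ e → paint C u c w ≤ paint C u c u
    max w w∈e rewrite updateAt-updates u {const c} C with paint-cases C u c w
    ... | inj₁ (_ , painted) rewrite painted = ≤-refl
    ... | inj₂ (_ , kept) rewrite kept = <⇒≤ (below w w∈e)
    unique : IsUniqueIn (paint C u c) e u
    unique w w∈e eq rewrite updateAt-updates u {const c} C with paint-cases C u c w
    ... | inj₁ (w≡u , _) = w≡u
    ... | inj₂ (_ , kept) = ⊥-elim (<⇒≢ (below w w∈e) (trans (sym kept) eq))

  paint-uniqueMaxUnlessUncoloured : ∀ {C e} u {c} → C u ≡ 0 → 0 < c →
    (inv : UniqueMaxUnlessUncoloured C e) → (u ∈ e → c ≢ C (top inv)) →
    UniqueMaxUnlessUncoloured (paint C u c) e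
  paint-uniqueMaxUnlessUncoloured {C} {e} u {c} Cu≡0 0<c (v , (v∈e , max) , zero-or-unique) c≢top
    with u ∈? e | <-cmp c (C v)
  ... | no u∉e | _ =
    uniqueMaxUnlessUncoloured-cong (λ w w∈e → paint-elsewhere C u c (λ { refl → u∉e w∈e }))
      (v , (v∈e , max) , zero-or-unique)
  ... | yes u∈e | tri≈ _ c≡Cv _ = ⊥-elim (c≢top u∈e c≡Cv)
  ... | yes u∈e | tri> _ _ Cv<c =
    u , map₂ inj₂ (paint-above-all u∈e (λ w w∈e → ≤-<-trans (max w w∈e) Cv<c))
  ... | yes u∈e | tri< c<Cv _ _ with zero-or-unique
  ...   | inj₁ Cv≡0 = ⊥-elim (n≮0 (subst (c <_) Cv≡0 c<Cv))
  ...   | inj₂ unique = v , map₂ inj₂ (paint-below-uniqueMax u v≢u c<Cv (v∈e , max) unique)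
    where
    v≢u : v ≢ u
    v≢u refl = n≮0 (subst (c <_) Cu≡0 c<Cv)

module Greedy (H : Hypergraph) (L : Fin (n H) → List ℕ)
              (L-size : (v : Fin (n H)) → IsListOfSize (suc (Δ H)) (L v)) where

  record PartialColouring : Set where
    field
      colour : Fin (n H) → ℕ
      fromLists : (v : Fin (n H)) → colour v ≡ 0 ⊎ colour v ∈ˡ L v
      invariant : (i : Fin (m H)) → UniqueMaxUnlessUncoloured colour (edge H i)

  open PartialColouring

  _⊑_ : PartialColouring → PartialColouring → Set
  P ⊑ Q = (v : Fin (n H)) → colour P v ≢ 0 → colour Q v ≢ 0

  uncoloured : PartialColouring
  uncoloured = record
    { colour = const 0
    ; fromLists = λ _ → inj₁ refl
    ; invariant = λ i → uncoloured-uniqueMaxUnlessUncoloured (edge-nonempty H i)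
    }

  edgesAt : Fin (n H) → List (Fin (m H))
  edgesAt u = filter (λ i → u ∈? edge H i) (allFin (m H))

  degree≤Δ : (u : Fin (n H)) → degree H u ≤ Δ H
  degree≤Δ u = ≤-foldr-⊔ (∈-map⁺ (degree H) (∈-allFin u))

  colourVertex : (P : PartialColouring) (u : Fin (n H)) → colour P u ≡ 0 →
                 Σ PartialColouring λ Q → P ⊑ Q × colour Q u ≢ 0
  colourVertex P u Pu≡0 = Q , P⊑Q , Qu≢0
    where
    topColour : Fin (m H) → ℕ
    topColour i = colour P (top (invariant P i))
    forbidden : List ℕ
    forbidden = map topColour (edgesAt u)
    forbidden<L : length forbidden < length (L u)
    forbidden<L = ≤-trans
      (s≤s (subst (_≤ Δ H) (sym (length-map topColour (edgesAt u))) (degree≤Δ u)))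
      (proj₂ (proj₂ (L-size u)))
    chosen : ∃ λ c → c ∈ˡ L u × c ∉ˡ forbidden
    chosen = ∃-∈-∉-shorter _≟ℕ_ (L u) forbidden (proj₁ (L-size u)) forbidden<L
    c : ℕ
    c = proj₁ chosen
    c∈L : c ∈ˡ L u
    c∈L = proj₁ (proj₂ chosen)
    0<c : 0 < c
    0<c = All.lookup (proj₁ (proj₂ (L-size u))) c∈L
    c≢top : (i : Fin (m H)) → u ∈ edge H i → c ≢ topColour i
    c≢top i u∈e c≡top = proj₂ (proj₂ chosen)
      (subst (_∈ˡ forbidden) (sym c≡top)
        (∈-map⁺ topColour (∈-filter⁺ (λ j → u ∈? edge H j) (∈-allFin i) u∈e)))
    Q : PartialColouring
    Q = record
      { colour = paint (colour P) u c
      ; fromLists = fromLists′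
      ; invariant = λ i → paint-uniqueMaxUnlessUncoloured u Pu≡0 0<c (invariant P i) (c≢top i)
      }
      where
      fromLists′ : (v : Fin (n H)) → paint (colour P) u c v ≡ 0 ⊎ paint (colour P) u c v ∈ˡ L v
      fromLists′ v with paint-cases (colour P) u c v
      ... | inj₁ (refl , painted) = inj₂ (subst (_∈ˡ L u) (sym painted) c∈L)
      ... | inj₂ (_ , kept) rewrite kept = fromLists P v
    Qu≢0 : colour Q u ≢ 0
    Qu≢0 Qu≡0 = <⇒≢ 0<c (sym (trans (sym (updateAt-updates u (colour P))) Qu≡0))
    P⊑Q : P ⊑ Q
    P⊑Q v Pv≢0 with paint-cases (colour P) u c v
    ... | inj₁ (refl , _) = Qu≢0
    ... | inj₂ (_ , kept) rewrite kept = Pv≢0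

  colourAll : (vs : List (Fin (n H))) (P : PartialColouring) →
              Σ PartialColouring λ Q → P ⊑ Q × ((v : Fin (n H)) → v ∈ˡ vs → colour Q v ≢ 0)
  colourAll [] P = P , (λ _ Pv≢0 → Pv≢0) , λ _ ()
  colourAll (u ∷ vs) P with colour P u ≟ℕ 0
  ... | no Pu≢0
    with Q , P⊑Q , Q-covers ← colourAll vs P
    = Q , P⊑Q , λ { v (here refl) → P⊑Q v Pu≢0 ; v (there v∈vs) → Q-covers v v∈vs }
  ... | yes Pu≡0
    with P′ , P⊑P′ , P′u≢0 ← colourVertex P u Pu≡0
    with Q , P′⊑Q , Q-covers ← colourAll vs P′
    = Q , (λ v Pv≢0 → P′⊑Q v (P⊑P′ v Pv≢0))
        , λ { v (here refl) → P′⊑Q v P′u≢0 ; v (there v∈vs) → Q-covers v v∈vs }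

  complete⇒listColouring : (P : PartialColouring) → ((v : Fin (n H)) → colour P v ≢ 0) →
    ((v : Fin (n H)) → colour P v ∈ˡ L v) × IsUMColoring H (colour P)
  complete⇒listColouring P coloured = fromList , uniqueMax
    where
    fromList : (v : Fin (n H)) → colour P v ∈ˡ L v
    fromList v with fromLists P v
    ... | inj₁ Pv≡0 = ⊥-elim (coloured v Pv≡0)
    ... | inj₂ Pv∈L = Pv∈L
    uniqueMax : IsUMColoring H (colour P)
    uniqueMax i with invariant P i
    ... | v , _ , inj₁ Pv≡0 = ⊥-elim (coloured v Pv≡0)
    ... | v , (v∈e , max) , inj₂ unique = v , v∈e , max , unique

mainTheorem12 : (H : Hypergraph) → UMChoosable H (suc (Δ H))
mainTheorem12 H L L-size =
  let open Greedy H L L-size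
      Q , _ , Q-covers = colourAll (allFin (n H)) uncoloured
  in PartialColouring.colour Q ,
     complete⇒listColouring Q (λ v → Q-covers v (∈-allFin v))
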